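{- Let $\phi$ be a multi-modal formula and $p$ a propositional variable not occurring in $\phi$. Then $\phi$ is preserved under induced substructures if and only if $(p\land\phi)\to\phi^p$ is valid. This equivalence holds both when "preserved" and "valid" are interpreted over the class of all Kripke models, and when both are interpreted over the class of all finite Kripke models.
   Context: Multi-modal formulas are built from propositional variables using Boolean connectives and modalities $\langle a\rangle,[a]$ for $a$ in an index set $A$, interpreted on Kripke models $M=(W,(R_a)_{a\in A},V)$. For $X\subseteq W$, $M|X$ denotes the restriction of $M$ to $X$ (relations and valuation restricted to $X$). A formula $\phi$ is preserved under induced substructures (over a class of models) if for every model $M$ in the class, every world $w$, and every $X\subseteq W$ with $w\in X$, $M,w\models\phi$ implies $M|X,w\models\phi$. The relativization $\phi^p$ of $\phi$ to $p$ is obtained by replacing every subformula $\langle a\rangle\psi$ by $\langle a\rangle(p\land\psi)$ and every $[a]\psi$ by $[a](p\to\psi)$ (recursively). A formula is valid over a class if it is true at every world of every model in the class. -}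

module Defs where

open import Data.Nat using (ℕ)
open import Data.Fin using (Fin)
open import Data.Product using (Σ; _×_; _,_; proj₁)
open import Data.Sum using (_⊎_)
open import Data.Empty using (⊥)
open import Data.Unit using (⊤)
open import Relation.Binary.PropositionalEquality using (_≡_)
open import Relation.Nullary using (¬_)
open import Function.Bundles using (_↔_)
open import Level using (Level; suc; zero)

data Form (A : Set) : Set where
  var  : ℕ → Form A
  ⊤f   : Form A
  ⊥f   : Form A
  ¬f_  : Form A → Form A
  _∧f_ : Form A → Form A → Form A
  _∨f_ : Form A → Form A → Form A
  _⇒f_ : Form A → Form A → Form A
  ⟨_⟩_ : A → Form A → Form A
  [_]_ : A → Form A → Form A

infixr 6 _∧f_
infixr 5 _∨f_
infixr 4 _⇒f_

record Model (A : Set) : Set₁ where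
  field
    W : Set
    R : A → W → W → Set
    V : W → ℕ → Set
open Model public

_,_⊨_ : {A : Set} (M : Model A) → W M → Form A → Set
M , w ⊨ var q    = V M w q
M , w ⊨ ⊤f       = ⊤
M , w ⊨ ⊥f       = ⊥
M , w ⊨ (¬f φ)   = ¬ (M , w ⊨ φ)
M , w ⊨ (φ ∧f ψ) = (M , w ⊨ φ) × (M , w ⊨ ψ)
M , w ⊨ (φ ∨f ψ) = (M , w ⊨ φ) ⊎ (M , w ⊨ ψ)
M , w ⊨ (φ ⇒f ψ) = (M , w ⊨ φ) → (M , w ⊨ ψ)
M , w ⊨ (⟨ a ⟩ φ) = Σ (W M) λ v → R M a w v × (M , v ⊨ φ)
M , w ⊨ ([ a ] φ) = ∀ v → R M a w v → M , v ⊨ φ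

_∣_ : {A : Set} (M : Model A) → (W M → Set) → Model A
W (M ∣ X) = Σ (W M) X
R (M ∣ X) a u v = R M a (proj₁ u) (proj₁ v)
V (M ∣ X) u q = V M (proj₁ u) q

AllModels : {A : Set} → Model A → Set
AllModels M = ⊤

FiniteModel : {A : Set} → Model A → Set
FiniteModel M = Σ ℕ λ n → W M ↔ Fin n

Preserved : {A : Set} → (Model A → Set) → Form A → Set₁
Preserved {A} K φ = (M : Model A) → K M → (X : W M → Set) → (w : W M) → (x : X w) →
  M , w ⊨ φ → (M ∣ X) , (w , x) ⊨ φ

Valid : {A : Set} → (Model A → Set) → Form A → Set₁
Valid {A} K φ = (M : Model A) → K M → (w : W M) → M , w ⊨ φ

rel : {A : Set} → ℕ → Form A → Form A
rel p (var q)    = var q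
rel p ⊤f         = ⊤f
rel p ⊥f         = ⊥f
rel p (¬f φ)     = ¬f (rel p φ)
rel p (φ ∧f ψ)   = rel p φ ∧f rel p ψ
rel p (φ ∨f ψ)   = rel p φ ∨f rel p ψ
rel p (φ ⇒f ψ)   = rel p φ ⇒f rel p ψ
rel p (⟨ a ⟩ φ)  = ⟨ a ⟩ (var p ∧f rel p φ)
rel p ([ a ] φ)  = [ a ] (var p ⇒f rel p φ)

Occurs : {A : Set} → ℕ → Form A → Set
Occurs p (var q)   = p ≡ q
Occurs p ⊤f        = ⊥
Occurs p ⊥f        = ⊥
Occurs p (¬f φ)    = Occurs p φ
Occurs p (φ ∧f ψ)  = Occurs p φ ⊎ Occurs p ψ
Occurs p (φ ∨f ψ)  = Occurs p φ ⊎ Occurs p ψ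
Occurs p (φ ⇒f ψ)  = Occurs p φ ⊎ Occurs p ψ
Occurs p (⟨ a ⟩ φ) = Occurs p φ
Occurs p ([ a ] φ) = Occurs p φ

{-# OPTIONS --safe #-}
module Submission where

-- Reading the valuation of p as a subset X = ⟦p⟧, the relativization φ^p says in M
-- exactly what φ says in M|X; so validity of (p ∧ φ) → φ^p is preservation of φ for
-- the subsets that p defines. Since p does not occur in φ, p may be re-interpreted as
-- an arbitrary subset X without changing the truth of φ, and re-interpreting a
-- variable keeps a model inside either class, as it leaves the frame untouched.

open import Defs
open import Data.Bool using (if_then_else_)
open import Data.Nat using (ℕ; _≟_)
open import Data.Product using (_×_; _,_; proj₁)
open import Data.Product.Function.Dependent.Propositional using (congˡ)
open import Data.Product.Function.NonDependent.Propositional using (_×-⇔_)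
open import Data.Sum using (inj₁; inj₂)
open import Data.Sum.Function.Propositional using (_⊎-⇔_)
open import Data.Unit using (tt)
open import Function using (_∘_)
open import Function.Bundles using (_⇔_; mk⇔; module Equivalence)
open import Function.Construct.Identity using (⇔-id)
open import Function.Related.Propositional using (equivalence)
open import Function.Related.TypeIsomorphisms using (→-cong-⇔; ¬-cong-⇔)
open import Relation.Binary.PropositionalEquality using (_≢_; refl; subst)
open import Relation.Nullary using (¬_; does)
open import Relation.Nullary.Decidable using (dec-true; dec-false)

open Equivalence using (to; from)

private
  variable
    A : Set

Π-⇔ : {I : Set} {B C : I → Set} → (∀ i → B i ⇔ C i) → ((i : I) → B i) ⇔ ((i : I) → C i)
Π-⇔ B⇔C = mk⇔ (λ f i → to (B⇔C i) (f i)) (λ g i → from (B⇔C i) (g i))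

withValuation : (M : Model A) → (W M → ℕ → Set) → Model A
withValuation M U = record { W = W M ; R = R M ; V = U }

_[_≔_] : (M : Model A) → ℕ → (W M → Set) → Model A
M [ p ≔ X ] = withValuation M λ v q → if does (q ≟ p) then X v else V M v q

module _ (M : Model A) (p : ℕ) (X : W M → Set) where

  update-≡ : ∀ v → V (M [ p ≔ X ]) v p ⇔ X v
  update-≡ v rewrite dec-true (p ≟ p) refl = ⇔-id _

  update-≢ : ∀ {q} → q ≢ p → ∀ v → V (M [ p ≔ X ]) v q ⇔ V M v q
  update-≢ {q} q≢p v rewrite dec-false (q ≟ p) q≢p = ⇔-id _

module _ (M : Model A) (U : W M → ℕ → Set) where

  ⊨-coincidence : (φ : Form A) → (∀ {q} → Occurs q φ → ∀ v → U v q ⇔ V M v q) →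
                  ∀ w → withValuation M U , w ⊨ φ ⇔ M , w ⊨ φ
  ⊨-coincidence (var q)   agree w = agree refl w
  ⊨-coincidence ⊤f        agree w = ⇔-id _
  ⊨-coincidence ⊥f        agree w = ⇔-id _
  ⊨-coincidence (¬f φ)    agree w = ¬-cong-⇔ (⊨-coincidence φ agree w)
  ⊨-coincidence (φ ∧f ψ)  agree w =
    ⊨-coincidence φ (agree ∘ inj₁) w ×-⇔ ⊨-coincidence ψ (agree ∘ inj₂) w
  ⊨-coincidence (φ ∨f ψ)  agree w =
    ⊨-coincidence φ (agree ∘ inj₁) w ⊎-⇔ ⊨-coincidence ψ (agree ∘ inj₂) w
  ⊨-coincidence (φ ⇒f ψ)  agree w =
    →-cong-⇔ (⊨-coincidence φ (agree ∘ inj₁) w) (⊨-coincidence ψ (agree ∘ inj₂) w)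
  ⊨-coincidence (⟨ a ⟩ φ) agree w =
    congˡ {k = equivalence} λ {v} → ⇔-id _ ×-⇔ ⊨-coincidence φ agree v
  ⊨-coincidence ([ a ] φ) agree w =
    Π-⇔ λ v → →-cong-⇔ (⇔-id _) (⊨-coincidence φ agree v)

module _ (M : Model A) (p : ℕ) (X : W M → Set) (p⇔X : ∀ v → V M v p ⇔ X v) where

  ∣-⊨⇔⊨-rel : (φ : Form A) (w : W M) (x : X w) → (M ∣ X) , (w , x) ⊨ φ ⇔ M , w ⊨ rel p φ
  ∣-⊨⇔⊨-rel (var q)   w x = ⇔-id _
  ∣-⊨⇔⊨-rel ⊤f        w x = ⇔-id _
  ∣-⊨⇔⊨-rel ⊥f        w x = ⇔-id _
  ∣-⊨⇔⊨-rel (¬f φ)    w x = ¬-cong-⇔ (∣-⊨⇔⊨-rel φ w x)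
  ∣-⊨⇔⊨-rel (φ ∧f ψ)  w x = ∣-⊨⇔⊨-rel φ w x ×-⇔ ∣-⊨⇔⊨-rel ψ w x
  ∣-⊨⇔⊨-rel (φ ∨f ψ)  w x = ∣-⊨⇔⊨-rel φ w x ⊎-⇔ ∣-⊨⇔⊨-rel ψ w x
  ∣-⊨⇔⊨-rel (φ ⇒f ψ)  w x = →-cong-⇔ (∣-⊨⇔⊨-rel φ w x) (∣-⊨⇔⊨-rel ψ w x)
  ∣-⊨⇔⊨-rel (⟨ a ⟩ φ) w x = mk⇔
    (λ ((v , x) , r , φv) → v , r , from (p⇔X v) x , to (∣-⊨⇔⊨-rel φ v x) φv)
    (λ (v , r , pv , φv) → (v , to (p⇔X v) pv) , r , from (∣-⊨⇔⊨-rel φ v _) φv)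
  ∣-⊨⇔⊨-rel ([ a ] φ) w x = mk⇔
    (λ □φ v r pv → to (∣-⊨⇔⊨-rel φ v _) (□φ (v , to (p⇔X v) pv) r))
    (λ □φ (v , x) r → from (∣-⊨⇔⊨-rel φ v x) (□φ v r (from (p⇔X v) x)))

RevaluationClosed : (Model A → Set) → Set₁
RevaluationClosed {A} K = (M : Model A) (U : W M → ℕ → Set) → K M → K (withValuation M U)

module _ {K : Model A → Set} (φ : Form A) (p : ℕ) where

  preserved⇒rel-valid : Preserved K φ → Valid K ((var p ∧f φ) ⇒f rel p φ)
  preserved⇒rel-valid preserved M k w (pw , φw) =
    to (∣-⊨⇔⊨-rel M p _ (λ _ → ⇔-id _) φ w pw) (preserved M k _ w pw φw)

  rel-valid⇒preserved : RevaluationClosed K → ¬ Occurs p φ →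
                        Valid K ((var p ∧f φ) ⇒f rel p φ) → Preserved K φ
  rel-valid⇒preserved closed p∉φ valid M k X w x φw =
    -- N ∣ X is, definitionally, M ∣ X with the valuation of N.
    to (⊨-coincidence (M ∣ X) (V (N ∣ X)) φ (λ occ → agree occ ∘ proj₁) (w , x)) N∣X⊨φ
    where
    N : Model A
    N = M [ p ≔ X ]

    agree : ∀ {q} → Occurs q φ → ∀ v → V N v q ⇔ V M v q
    agree occ = update-≢ M p X λ q≡p → p∉φ (subst (λ r → Occurs r φ) q≡p occ)

    N⊨φ^p : N , w ⊨ rel p φ
    N⊨φ^p = valid N (closed M (V N) k) w
      (from (update-≡ M p X w) x , from (⊨-coincidence M (V N) φ agree w) φw)

    N∣X⊨φ : (N ∣ X) , (w , x) ⊨ φ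
    N∣X⊨φ = from (∣-⊨⇔⊨-rel N p X (update-≡ M p X) φ w x) N⊨φ^p

  preserved⇔rel-valid : RevaluationClosed K → ¬ Occurs p φ →
                        Preserved K φ ⇔ Valid K ((var p ∧f φ) ⇒f rel p φ)
  preserved⇔rel-valid closed p∉φ =
    mk⇔ preserved⇒rel-valid (rel-valid⇒preserved closed p∉φ)

proposition2p5 : {A : Set} (φ : Form A) (p : ℕ) → ¬ Occurs p φ →
    (Preserved AllModels φ ⇔ Valid AllModels ((var p ∧f φ) ⇒f rel p φ))
    × (Preserved FiniteModel φ ⇔ Valid FiniteModel ((var p ∧f φ) ⇒f rel p φ))
proposition2p5 φ p p∉φ =
  preserved⇔rel-valid φ p (λ _ _ _ → tt) p∉φ ,
  preserved⇔rel-valid φ p (λ _ _ finite → finite) p∉φ
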